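{- Let $p$ be a fixed odd prime, let $q\in\mathbb{C}_p$ with $|q-1|_p<1$, and let the $q$-Euler numbers $\widetilde{E}_{n,q}$ ($n\ge 0$) be defined by $$\frac{[2]_q}{qe^{t}+1}=\sum_{n=0}^{\infty}\widetilde{E}_{n,q}\frac{t^n}{n!},\qquad [2]_q=1+q.$$ Then for all natural numbers $k,m$, $$\sum_{j=1}^{\max\{k,m\}}\left[q\binom{k}{j}+(-1)^j\binom{m}{j}\right]\frac{\widetilde{E}_{k+m-j+1,q}}{k+m-j+1} = q\,\frac{(-1)^{m+1}}{(k+m+1)\binom{k+m}{k}}-[2]_q\,\frac{\widetilde{E}_{k+m+1,q}}{k+m+1}.$$
   Context: $\mathbb{C}_p$ is the completion of an algebraic closure of $\mathbb{Q}_p$, and $|\cdot|_p$ is the $p$-adic absolute value with $|p|_p=1/p$. The generating function is understood as a formal power series in $t$. Binomial coefficients $\binom{a}{j}$ with $j>a\ge 0$ are taken to be $0$. Equivalently, $\widetilde{E}_{n,q}=\int_{\mathbb{Z}_p}y^n\,d\mu_{ -q}(y)$ for Kim's fermionic $p$-adic $q$-integral. -}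

module Defs where

open import Level using (Level)
open import Data.Nat as ℕ using (ℕ; zero; suc; _∸_; _⊔_)
open import Data.Nat.Combinatorics using (_C_)
open import Algebra.Bundles using (CommutativeRing)

module _ {c ℓ : Level} (R : CommutativeRing c ℓ) where
  open CommutativeRing R

  fromℕ : ℕ → Carrier
  fromℕ zero    = 0#
  fromℕ (suc n) = 1# + fromℕ n

  sgn : ℕ → Carrier
  sgn zero    = 1#
  sgn (suc j) = - sgn j

  -- ∑_{j=a}^{b} f j  (empty if b < a); defined as ∑_{i<b+1-a} f (a+i)
  sumRange : ℕ → ℕ → (ℕ → Carrier) → Carrier
  sumRange a b f = go (suc b ∸ a) a
    where
    go : ℕ → ℕ → Carrier
    go zero    _ = 0#
    go (suc n) i = f i + go n (suc i)

  two-q : Carrier → Carrier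
  two-q q = 1# + q

  -- Coefficient of t^n/n! in (q e^t + 1) · ∑ E_n t^n/n!  equals that of [2]_q:
  --   q ∑_{l=0}^{n} C(n,l) E_l + E_n = [2]_q δ_{n,0}.
  -- This is exactly the formal power series identity  [2]_q/(q e^t+1) = ∑ E_n t^n/n!
  -- (multiplied out by the invertible series q e^t + 1).
  IsQEuler : Carrier → (ℕ → Carrier) → Set ℓ
  IsQEuler q E = ∀ n →
    q * sumRange 0 n (λ l → fromℕ (n C l) * E l) + E n ≈ rhs n
    where
    rhs : ℕ → Carrier
    rhs zero    = two-q q
    rhs (suc _) = 0#

module Submission where

-- Write γ_{k,m}(j) = q C(k,j) + (-1)^j C(m,j), N = k + m, e_n = E_n / n, and
--   T(k,m) = ∑_{j=0}^{N} γ_{k,m}(j) e_{N+1-j}.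
-- The j = 0 term of T(k,m) is [2]_q e_{N+1} and γ_{k,m}(j) vanishes for
-- j > max(k,m), so the theorem says exactly  T(k,m) = q (-1)^{m+1} β(k,m)
-- with β(k,m) = 1 / ((N+1) C(N,k)), the Beta integral ∫₀¹ x^k (1-x)^m dx.
-- Both sides obey the same two-variable recursion, which we prove by
-- induction on m:
--   * Pascal's rule gives  T(k+1,m) = T(k,m+1) + T(k,m), and the
--     absorption identities for binomials give β(k,m+1) + β(k+1,m) = β(k,m);
--   * at m = 0 the q-Euler recurrence  q ∑_l C(k+1,l) E_l + E_{k+1} = 0,
--     together with E_0 = 1, gives  T(k,0) = -q/(k+1).

open import Defs
open import Level using (Level)
open import Data.Nat as ℕ using (ℕ)
open import Data.Nat.Combinatorics using (_C_)
open import Algebra.Bundles using (CommutativeRing)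
open import Relation.Binary.PropositionalEquality using (_≢_)

import Data.Nat.Properties as ℕₚ
import Relation.Binary.PropositionalEquality as P
open import Algebra.Properties.CommutativeSemigroup ℕₚ.*-commutativeSemigroup
  using () renaming (x∙yz≈y∙xz to m*[n*o]≡n*[m*o])

module Binomial where
  open import Data.Nat.Base using (zero; suc; _+_; _*_; _≤_; z≤n; s≤s; z<s; s<s)
  open import Data.Nat.Properties
  open import Data.Nat.Combinatorics
  open import Data.Sum.Base using (inj₁; inj₂)
  open import Relation.Binary.PropositionalEquality
  open ≡-Reasoning

  C-absorption : ∀ n j → suc j * (suc n C suc j) ≡ suc n * (n C j)
  C-absorption n zero = begin
    1 * (suc n C 1)  ≡⟨ *-identityˡ _ ⟩
    suc n C 1        ≡⟨ nC1≡n (suc n) ⟩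
    suc n            ≡⟨ *-identityʳ (suc n) ⟨
    suc n * 1        ∎
  C-absorption zero (suc j) = begin
    suc (suc j) * (1 C suc (suc j)) ≡⟨ cong (suc (suc j) *_) (k>n⇒nCk≡0 {1} {suc (suc j)} (s<s z<s)) ⟩
    suc (suc j) * 0                 ≡⟨ *-zeroʳ (suc (suc j)) ⟩
    0                               ≡⟨ cong (1 *_) (k>n⇒nCk≡0 {0} {suc j} z<s) ⟨
    1 * (0 C suc j)                 ∎
  C-absorption (suc n) (suc j) = begin
    (2 + j) * (suc (suc n) C suc (suc j))            ≡⟨ cong ((2 + j) *_) (nCk+nC[k+1]≡[n+1]C[k+1] (suc n) (suc j)) ⟨
    (2 + j) * (b + b′)                               ≡⟨ *-distribˡ-+ (2 + j) b b′ ⟩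
    (b + (1 + j) * b) + (2 + j) * b′                 ≡⟨ cong₂ (λ x y → (b + x) + y) (C-absorption n j) (C-absorption n (suc j)) ⟩
    (b + (1 + n) * (n C j)) + (1 + n) * (n C suc j)  ≡⟨ +-assoc b _ _ ⟩
    b + ((1 + n) * (n C j) + (1 + n) * (n C suc j))  ≡⟨ cong (b +_) (*-distribˡ-+ (1 + n) (n C j) _) ⟨
    b + (1 + n) * (n C j + n C suc j)                ≡⟨ cong (λ t → b + (1 + n) * t) (nCk+nC[k+1]≡[n+1]C[k+1] n j) ⟩
    (2 + n) * b                                      ∎
    where
    b  = suc n C suc j
    b′ = suc n C suc (suc j)

  C-sym : ∀ k m → (k + m) C k ≡ (k + m) C m
  C-sym k m = trans (nCk≡nC[n∸k] (m≤m+n k m)) (cong ((k + m) C_) (m+n∸m≡n k m))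

  C-absorption′ : ∀ k m → suc m * (suc (k + m) C k) ≡ suc (k + m) * ((k + m) C k)
  C-absorption′ k m = begin
    suc m * (suc (k + m) C k)      ≡⟨ cong (λ n → suc m * (n C k)) (+-suc k m) ⟨
    suc m * ((k + suc m) C k)      ≡⟨ cong (suc m *_) (C-sym k (suc m)) ⟩
    suc m * ((k + suc m) C suc m)  ≡⟨ cong (λ n → suc m * (n C suc m)) (+-suc k m) ⟩
    suc m * (suc (k + m) C suc m)  ≡⟨ C-absorption (k + m) m ⟩
    suc (k + m) * ((k + m) C m)    ≡⟨ cong (suc (k + m) *_) (C-sym k m) ⟨
    suc (k + m) * ((k + m) C k)    ∎

  *-nonzero : ∀ {m n} → m ≢ 0 → n ≢ 0 → m * n ≢ 0
  *-nonzero {m} m≢0 n≢0 mn≡0 with m*n≡0⇒m≡0∨n≡0 m mn≡0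
  ... | inj₁ m≡0 = m≢0 m≡0
  ... | inj₂ n≡0 = n≢0 n≡0

  -- C(n,k) ≠ 0 for k ≤ n: by absorption, (k+1) C(n+1,k+1) = (n+1) C(n,k) ≠ 0.
  C-nonzero : ∀ {n k} → k ≤ n → n C k ≢ 0
  C-nonzero z≤n ()
  C-nonzero {suc n} {suc k} (s≤s k≤n) C≡0 =
    *-nonzero {suc n} (λ ()) (C-nonzero k≤n) (begin
      suc n * (n C k)          ≡⟨ C-absorption n k ⟨
      suc k * (suc n C suc k)  ≡⟨ cong (suc k *_) C≡0 ⟩
      suc k * 0                ≡⟨ *-zeroʳ (suc k) ⟩
      0                        ∎)

open Binomial

module Development {c ℓ : Level} (R : CommutativeRing c ℓ) where
  open CommutativeRing R
  open import Data.Nat.Combinatorics using (nCk≡nC[n∸k]; k>n⇒nCk≡0; nCn≡1; nCk+nC[k+1]≡[n+1]C[k+1])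
  open import Algebra.Properties.Ring ring using (-‿distribʳ-*; -1*x≈-x)
  open import Algebra.Properties.Group +-group using (∙-cancelʳ; inverseˡ-unique)
  open import Algebra.Properties.Semiring.Mult semiring using (_×_; ×-homo-+; ×1-homo-*)
  open import Algebra.Solver.Ring.NaturalCoefficients.Default commutativeSemiring
    using (solve; _:+_; _:*_; _:=_; con)
  open import Relation.Binary.Reasoning.Setoid setoid
  open import Relation.Nullary.Decidable using (yes; no)
  open import Algebra.Properties.CommutativeSemigroup *-commutativeSemigroup
    using (x∙yz≈y∙xz; x∙yz≈yx∙z; interchange)
  open import Algebra.Properties.CommutativeSemigroup +-commutativeSemigroup
    using () renaming (interchange to +-interchange)

  -- The canonical map ℕ → R is a semiring homomorphism, since it agrees
  -- with the library's iterated addition n × 1#.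
  ι : ℕ → Carrier
  ι = fromℕ R

  ι≡× : ∀ n → ι n P.≡ n × 1#
  ι≡× ℕ.zero    = P.refl
  ι≡× (ℕ.suc n) = P.cong (1# +_) (ι≡× n)

  ι-1 : ι 1 ≈ 1#
  ι-1 = +-identityʳ 1#

  ι-+ : ∀ m n → ι (m ℕ.+ n) ≈ ι m + ι n
  ι-+ m n = begin
    ι (m ℕ.+ n)       ≡⟨ ι≡× (m ℕ.+ n) ⟩
    (m ℕ.+ n) × 1#    ≈⟨ ×-homo-+ 1# m n ⟩
    m × 1# + n × 1#   ≡⟨ P.cong₂ _+_ (ι≡× m) (ι≡× n) ⟨
    ι m + ι n         ∎

  ι-* : ∀ m n → ι (m ℕ.* n) ≈ ι m * ι n
  ι-* m n = begin
    ι (m ℕ.* n)          ≡⟨ ι≡× (m ℕ.* n) ⟩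
    (m ℕ.* n) × 1#       ≈⟨ ×1-homo-* m n ⟩
    (m × 1#) * (n × 1#)  ≡⟨ P.cong₂ _*_ (ι≡× m) (ι≡× n) ⟨
    ι m * ι n            ∎

  ι-absorption : ∀ n j → ι (ℕ.suc n) * ι (n C j) ≈ ι (ℕ.suc j) * ι (ℕ.suc n C ℕ.suc j)
  ι-absorption n j = begin
    ι (ℕ.suc n) * ι (n C j)                 ≈⟨ ι-* (ℕ.suc n) (n C j) ⟨
    ι (ℕ.suc n ℕ.* (n C j))                 ≡⟨ P.cong ι (C-absorption n j) ⟨
    ι (ℕ.suc j ℕ.* (ℕ.suc n C ℕ.suc j))     ≈⟨ ι-* (ℕ.suc j) (ℕ.suc n C ℕ.suc j) ⟩
    ι (ℕ.suc j) * ι (ℕ.suc n C ℕ.suc j)     ∎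

  neg-cancel : ∀ s x → - s * x + s * x ≈ 0#
  neg-cancel s x = begin
    - s * x + s * x  ≈⟨ distribʳ x (- s) s ⟨
    (- s + s) * x    ≈⟨ *-congʳ (-‿inverseˡ s) ⟩
    0# * x           ≈⟨ zeroˡ x ⟩
    0#               ∎

  ∑ : ℕ → (ℕ → Carrier) → Carrier
  ∑ ℕ.zero    f = 0#
  ∑ (ℕ.suc n) f = f 0 + ∑ n (λ j → f (ℕ.suc j))

  ∑-cong : ∀ n {f g} → (∀ j → j ℕ.< n → f j ≈ g j) → ∑ n f ≈ ∑ n g
  ∑-cong ℕ.zero    f≈g = refl
  ∑-cong (ℕ.suc n) f≈g = +-cong (f≈g 0 (ℕ.s≤s ℕ.z≤n)) (∑-cong n (λ j j<n → f≈g (ℕ.suc j) (ℕ.s≤s j<n)))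

  ∑-zero : ∀ n {f} → (∀ j → f j ≈ 0#) → ∑ n f ≈ 0#
  ∑-zero ℕ.zero    f≈0 = refl
  ∑-zero (ℕ.suc n) f≈0 = trans (+-cong (f≈0 0) (∑-zero n (λ j → f≈0 (ℕ.suc j)))) (+-identityˡ 0#)

  ∑-+ : ∀ n f g → ∑ n f + ∑ n g ≈ ∑ n (λ j → f j + g j)
  ∑-+ ℕ.zero    f g = +-identityˡ 0#
  ∑-+ (ℕ.suc n) f g = trans (+-interchange _ _ _ _) (+-congˡ (∑-+ n _ _))

  ∑-*ˡ : ∀ n a f → a * ∑ n f ≈ ∑ n (λ j → a * f j)
  ∑-*ˡ ℕ.zero    a f = zeroʳ a
  ∑-*ˡ (ℕ.suc n) a f = trans (distribˡ a _ _) (+-congˡ (∑-*ˡ n a _))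

  ∑-split : ∀ m n f → ∑ (m ℕ.+ n) f ≈ ∑ m f + ∑ n (λ j → f (m ℕ.+ j))
  ∑-split ℕ.zero    n f = sym (+-identityˡ _)
  ∑-split (ℕ.suc m) n f = trans (+-congˡ (∑-split m n (λ j → f (ℕ.suc j)))) (sym (+-assoc _ _ _))

  ∑-last : ∀ n f → ∑ (ℕ.suc n) f ≈ ∑ n f + f n
  ∑-last ℕ.zero    f = trans (+-identityʳ _) (sym (+-identityˡ _))
  ∑-last (ℕ.suc n) f = trans (+-congˡ (∑-last n (λ j → f (ℕ.suc j)))) (sym (+-assoc _ _ _))

  ∑-reverse : ∀ n f → ∑ n f ≈ ∑ n (λ j → f (n ℕ.∸ ℕ.suc j))
  ∑-reverse ℕ.zero    f = refl
  ∑-reverse (ℕ.suc n) f = begin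
    f 0 + ∑ n (λ j → f (ℕ.suc j))                      ≈⟨ +-congˡ (∑-reverse n (λ j → f (ℕ.suc j))) ⟩
    f 0 + ∑ n (λ j → f (ℕ.suc (n ℕ.∸ ℕ.suc j)))        ≈⟨ +-comm _ _ ⟩
    ∑ n (λ j → f (ℕ.suc (n ℕ.∸ ℕ.suc j))) + f 0        ≈⟨ +-cong (∑-cong n λ j j<n → reflexive (P.cong f (P.sym (ℕₚ.+-∸-assoc 1 j<n))))
                                                                 (reflexive (P.cong f (P.sym (ℕₚ.n∸n≡0 n)))) ⟩
    ∑ n (λ j → f (n ℕ.∸ j)) + f (n ℕ.∸ n)             ≈⟨ ∑-last n (λ j → f (n ℕ.∸ j)) ⟨
    ∑ (ℕ.suc n) (λ j → f (n ℕ.∸ j))                   ∎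

  ∑-truncate : ∀ {m n} f → m ℕ.≤ n → (∀ j → f (m ℕ.+ j) ≈ 0#) → ∑ n f ≈ ∑ m f
  ∑-truncate {m} {n} f m≤n tail≈0 = begin
    ∑ n f                                         ≡⟨ P.cong (λ t → ∑ t f) (ℕₚ.m+[n∸m]≡n m≤n) ⟨
    ∑ (m ℕ.+ (n ℕ.∸ m)) f                         ≈⟨ ∑-split m (n ℕ.∸ m) f ⟩
    ∑ m f + ∑ (n ℕ.∸ m) (λ j → f (m ℕ.+ j))       ≈⟨ +-congˡ (∑-zero (n ℕ.∸ m) tail≈0) ⟩
    ∑ m f + 0#                                    ≈⟨ +-identityʳ _ ⟩
    ∑ m f                                         ∎

  sumRange≈∑ : ∀ n a b f → ℕ.suc b ℕ.∸ a P.≡ n → sumRange R a b f ≈ ∑ n (λ j → f (a ℕ.+ j))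
  sumRange≈∑ ℕ.zero a b f count with a ℕ.≤? b
  ... | yes a≤b with () ← P.trans (P.sym (ℕₚ.+-∸-assoc 1 a≤b)) count
  ... | no a≰b = reflexive empty
    where
    empty : sumRange R a b f P.≡ 0#
    empty rewrite ℕₚ.m≤n⇒m∸n≡0 (ℕₚ.≰⇒> a≰b) = P.refl
  sumRange≈∑ (ℕ.suc n) a b f count with a ℕ.≤? b
  ... | no a≰b with () ← P.trans (P.sym (ℕₚ.m≤n⇒m∸n≡0 (ℕₚ.≰⇒> a≰b))) count
  ... | yes a≤b = begin
    sumRange R a b f                             ≡⟨ peel ⟩
    f a + sumRange R (ℕ.suc a) b f               ≈⟨ +-cong (reflexive (P.cong f (P.sym (ℕₚ.+-identityʳ a))))
                                                           (sumRange≈∑ n (ℕ.suc a) b f count′) ⟩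
    f (a ℕ.+ 0) + ∑ n (λ j → f (ℕ.suc a ℕ.+ j))  ≈⟨ +-congˡ (∑-cong n λ j _ → reflexive (P.cong f (P.sym (ℕₚ.+-suc a j)))) ⟩
    ∑ (ℕ.suc n) (λ j → f (a ℕ.+ j))              ∎
    where
    peel : sumRange R a b f P.≡ f a + sumRange R (ℕ.suc a) b f
    peel rewrite ℕₚ.+-∸-assoc 1 a≤b = P.refl
    count′ : b ℕ.∸ a P.≡ n
    count′ = ℕₚ.suc-injective (P.trans (P.sym (ℕₚ.+-∸-assoc 1 a≤b)) count)

  module Convolution (e : ℕ → Carrier) where

    conv : (ℕ → Carrier) → ℕ → Carrier
    conv c n = ∑ (ℕ.suc n) (λ j → c j * e (ℕ.suc n ℕ.∸ j))

    conv-cong : ∀ n {c d} → (∀ j → c j ≈ d j) → conv c n ≈ conv d n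
    conv-cong n {c} {d} c≈d = ∑-cong (ℕ.suc n) {λ j → c j * e (ℕ.suc n ℕ.∸ j)} (λ j _ → *-congʳ (c≈d j))

    conv-+ : ∀ n c d → conv c n + conv d n ≈ conv (λ j → c j + d j) n
    conv-+ n c d = trans (∑-+ (ℕ.suc n) (λ j → c j * e (ℕ.suc n ℕ.∸ j)) (λ j → d j * e (ℕ.suc n ℕ.∸ j)))
                         (∑-cong (ℕ.suc n) (λ j _ → sym (distribʳ (e (ℕ.suc n ℕ.∸ j)) (c j) (d j))))

    conv-*ˡ : ∀ n a c → a * conv c n ≈ conv (λ j → a * c j) n
    conv-*ˡ n a c = trans (∑-*ˡ (ℕ.suc n) a (λ j → c j * e (ℕ.suc n ℕ.∸ j)))
                          (∑-cong (ℕ.suc n) (λ j _ → sym (*-assoc a (c j) (e (ℕ.suc n ℕ.∸ j)))))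

    conv-pascal : ∀ n {b c d} → d 0 ≈ c 0 → (∀ j → d (ℕ.suc j) ≈ c (ℕ.suc j) + b j) →
                  conv d (ℕ.suc n) ≈ conv c (ℕ.suc n) + conv b n
    conv-pascal n {b} {c} {d} d₀≈c₀ d≈c+b = begin
      d 0 * e₀ + conv (λ j → d (ℕ.suc j)) n                         ≈⟨ +-cong (*-congʳ d₀≈c₀) (conv-cong n d≈c+b) ⟩
      c 0 * e₀ + conv (λ j → c (ℕ.suc j) + b j) n                   ≈⟨ +-congˡ (conv-+ n (λ j → c (ℕ.suc j)) b) ⟨
      c 0 * e₀ + (conv (λ j → c (ℕ.suc j)) n + conv b n)            ≈⟨ +-assoc _ _ _ ⟨
      (c 0 * e₀ + conv (λ j → c (ℕ.suc j)) n) + conv b n            ∎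
      where e₀ = e (ℕ.suc (ℕ.suc n))

  module Inverses (inv : ℕ → Carrier) (inv-correct : ∀ n → n ≢ 0 → ι n * inv n ≈ 1#) where

    inv-unique : ∀ {n x} → n ≢ 0 → ι n * x ≈ 1# → x ≈ inv n
    inv-unique {n} {x} n≢0 nx≈1 = begin
      x                    ≈⟨ *-identityʳ x ⟨
      x * 1#               ≈⟨ *-congˡ (inv-correct n n≢0) ⟨
      x * (ι n * inv n)    ≈⟨ *-assoc x (ι n) (inv n) ⟨
      (x * ι n) * inv n    ≈⟨ *-congʳ (trans (*-comm x (ι n)) nx≈1) ⟩
      1# * inv n           ≈⟨ *-identityˡ (inv n) ⟩
      inv n                ∎

    ι-inv-cancel : ∀ {n} x → n ≢ 0 → ι n * (x * inv n) ≈ x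
    ι-inv-cancel {n} x n≢0 = begin
      ι n * (x * inv n)    ≈⟨ x∙yz≈y∙xz (ι n) x (inv n) ⟩
      x * (ι n * inv n)    ≈⟨ *-congˡ (inv-correct n n≢0) ⟩
      x * 1#               ≈⟨ *-identityʳ x ⟩
      x                    ∎

    ι-cancel : ∀ {n x} → n ≢ 0 → ι n * x ≈ 0# → x ≈ 0#
    ι-cancel {n} {x} n≢0 nx≈0 = begin
      x                    ≈⟨ *-identityˡ x ⟨
      1# * x               ≈⟨ *-congʳ (trans (*-comm _ _) (inv-correct n n≢0)) ⟨
      (inv n * ι n) * x    ≈⟨ *-assoc (inv n) (ι n) x ⟩
      inv n * (ι n * x)    ≈⟨ *-congˡ nx≈0 ⟩
      inv n * 0#           ≈⟨ zeroʳ (inv n) ⟩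
      0#                   ∎

    inv-cross : ∀ x {y a b} → y ≢ 0 → a ≢ 0 → b ≢ 0 → x ℕ.* y P.≡ a ℕ.* b →
                ι x * (inv a * inv b) ≈ inv y
    inv-cross x {y} {a} {b} y≢0 a≢0 b≢0 xy≡ab = inv-unique y≢0 (begin
      ι y * (ι x * (inv a * inv b))          ≈⟨ x∙yz≈yx∙z (ι y) (ι x) (inv a * inv b) ⟩
      (ι x * ι y) * (inv a * inv b)          ≈⟨ *-congʳ (ι-* x y) ⟨
      ι (x ℕ.* y) * (inv a * inv b)          ≡⟨ P.cong (λ t → ι t * (inv a * inv b)) xy≡ab ⟩
      ι (a ℕ.* b) * (inv a * inv b)          ≈⟨ *-congʳ (ι-* a b) ⟩
      (ι a * ι b) * (inv a * inv b)          ≈⟨ interchange (ι a) (ι b) (inv a) (inv b) ⟩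
      (ι a * inv a) * (ι b * inv b)          ≈⟨ *-cong (inv-correct a a≢0) (inv-correct b b≢0) ⟩
      1# * 1#                                ≈⟨ *-identityˡ 1# ⟩
      1#                                     ∎)

    -- β k m = 1 / ((k+m+1) C(k+m,k)), the Beta integral ∫₀¹ x^k (1-x)^m dx.
    β : ℕ → ℕ → Carrier
    β k m = inv (ℕ.suc (k ℕ.+ m) ℕ.* ((k ℕ.+ m) C k))

    -- x^k (1-x)^m = x^k (1-x)^{m+1} + x^{k+1} (1-x)^m, integrated.
    β-rec : ∀ k m → β k (ℕ.suc m) + β (ℕ.suc k) m ≈ β k m
    β-rec k m = begin
      β k (ℕ.suc m) + β (ℕ.suc k) m                                ≡⟨ P.cong (λ t → inv (ℕ.suc t ℕ.* (t C k)) + β (ℕ.suc k) m) (ℕₚ.+-suc k m) ⟩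
      inv (a ℕ.* (ℕ.suc N C k)) + inv (a ℕ.* (ℕ.suc N C ℕ.suc k))  ≈⟨ +-cong (inv-cross (ℕ.suc m) (d-nonzero (ℕₚ.m≤n⇒m≤1+n k≤N)) a≢0 b≢0 cross)
                                                                               (inv-cross (ℕ.suc k) (d-nonzero (ℕ.s≤s k≤N)) a≢0 b≢0 cross′) ⟨
      ι (ℕ.suc m) * (inv a * inv b) + ι (ℕ.suc k) * (inv a * inv b)  ≈⟨ distribʳ _ (ι (ℕ.suc m)) (ι (ℕ.suc k)) ⟨
      (ι (ℕ.suc m) + ι (ℕ.suc k)) * (inv a * inv b)                ≈⟨ *-congʳ (ι-+ (ℕ.suc m) (ℕ.suc k)) ⟨
      ι (ℕ.suc m ℕ.+ ℕ.suc k) * (inv a * inv b)                    ≡⟨ P.cong (λ t → ι t * (inv a * inv b)) m+1+k+1≡a ⟩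
      ι a * (inv a * inv b)                                        ≈⟨ *-assoc _ _ _ ⟨
      (ι a * inv a) * inv b                                        ≈⟨ *-congʳ (inv-correct a a≢0) ⟩
      1# * inv b                                                   ≈⟨ *-identityˡ (inv b) ⟩
      inv b                                                        ∎
      where
      N = k ℕ.+ m
      a = ℕ.suc (ℕ.suc N)
      b = ℕ.suc N ℕ.* (N C k)
      k≤N : k ℕ.≤ N
      k≤N = ℕₚ.m≤m+n k m
      a≢0 : a ≢ 0
      a≢0 ()
      b≢0 : b ≢ 0
      b≢0 = *-nonzero {ℕ.suc N} (λ ()) (C-nonzero k≤N)
      d-nonzero : ∀ {i} → i ℕ.≤ ℕ.suc N → a ℕ.* (ℕ.suc N C i) ≢ 0
      d-nonzero i≤N+1 = *-nonzero a≢0 (C-nonzero i≤N+1)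
      m+1+k+1≡a : ℕ.suc m ℕ.+ ℕ.suc k P.≡ a
      m+1+k+1≡a = P.cong ℕ.suc (P.trans (ℕₚ.+-suc m k) (P.cong ℕ.suc (ℕₚ.+-comm m k)))
      cross : (ℕ.suc m) ℕ.* (a ℕ.* (ℕ.suc N C k)) P.≡ a ℕ.* b
      cross = P.trans (m*[n*o]≡n*[m*o] (ℕ.suc m) a (ℕ.suc N C k)) (P.cong (a ℕ.*_) (C-absorption′ k m))
      cross′ : (ℕ.suc k) ℕ.* (a ℕ.* (ℕ.suc N C ℕ.suc k)) P.≡ a ℕ.* b
      cross′ = P.trans (m*[n*o]≡n*[m*o] (ℕ.suc k) a (ℕ.suc N C ℕ.suc k)) (P.cong (a ℕ.*_) (C-absorption N k))

  alternating : ∀ (a : Carrier) (T w : ℕ → ℕ → Carrier) →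
    (∀ k → T k 0 ≈ a * (sgn R 1 * w k 0)) →
    (∀ k m → T (ℕ.suc k) m ≈ T k (ℕ.suc m) + T k m) →
    (∀ k m → w k (ℕ.suc m) + w (ℕ.suc k) m ≈ w k m) →
    ∀ m k → T k m ≈ a * (sgn R (ℕ.suc m) * w k m)
  alternating a T w T-base T-rec w-rec ℕ.zero    k = T-base k
  alternating a T w T-base T-rec w-rec (ℕ.suc m) k =
    ∙-cancelʳ (T k m) (T k (ℕ.suc m)) (a * (- s * w₂)) (begin
      T k (ℕ.suc m) + T k m                      ≈⟨ T-rec k m ⟨
      T (ℕ.suc k) m                              ≈⟨ IH (ℕ.suc k) ⟩
      a * (s * w₁)                               ≈⟨ +-identityˡ _ ⟨
      0# + a * (s * w₁)                          ≈⟨ +-congʳ (trans (*-congˡ (neg-cancel s w₂)) (zeroʳ a)) ⟨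
      a * (- s * w₂ + s * w₂) + a * (s * w₁)     ≈⟨ regroup a (- s) s w₂ w₁ ⟩
      a * (- s * w₂) + a * (s * (w₂ + w₁))       ≈⟨ +-congˡ (*-congˡ (*-congˡ (w-rec k m))) ⟩
      a * (- s * w₂) + a * (s * w k m)           ≈⟨ +-congˡ (IH k) ⟨
      a * (- s * w₂) + T k m                     ∎)
    where
    IH = alternating a T w T-base T-rec w-rec m
    s  = sgn R (ℕ.suc m)
    w₁ = w (ℕ.suc k) m
    w₂ = w k (ℕ.suc m)
    regroup : ∀ a t s x y → a * (t * x + s * x) + a * (s * y) ≈ a * (t * x) + a * (s * (x + y))
    regroup = solve 5 (λ a t s x y → a :* (t :* x :+ s :* x) :+ a :* (s :* y) := a :* (t :* x) :+ a :* (s :* (x :+ y))) refl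

  module QEuler (inv : ℕ → Carrier) (inv-correct : ∀ n → n ≢ 0 → ι n * inv n ≈ 1#)
                (q u : Carrier) ([2]u≈1 : two-q R q * u ≈ 1#)
                (E : ℕ → Carrier) (isQEuler : IsQEuler R q E) where
    open Inverses inv inv-correct public

    e : ℕ → Carrier
    e n = E n * inv n

    open Convolution e

    -- The defining recurrence at n = 0 reads [2]_q E₀ = [2]_q, and [2]_q is a unit.
    E₀≈1 : E 0 ≈ 1#
    E₀≈1 = begin
      E 0                    ≈⟨ *-identityˡ (E 0) ⟨
      1# * E 0               ≈⟨ *-congʳ (trans (*-comm u _) [2]u≈1) ⟨
      (u * two-q R q) * E 0  ≈⟨ *-assoc u _ (E 0) ⟩
      u * (two-q R q * E 0)  ≈⟨ *-congˡ [2]E₀≈[2] ⟩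
      u * two-q R q          ≈⟨ trans (*-comm u _) [2]u≈1 ⟩
      1#                     ∎
      where
      [2]E₀≈[2] : two-q R q * E 0 ≈ two-q R q
      [2]E₀≈[2] = begin
        (1# + q) * E 0               ≈⟨ expand q (E 0) ⟩
        q * (1# * E 0 + 0#) + E 0    ≈⟨ +-congʳ (*-congˡ (+-congʳ (*-congʳ ι-1))) ⟨
        q * (ι 1 * E 0 + 0#) + E 0   ≈⟨ isQEuler 0 ⟩
        1# + q                       ∎
        where
        expand : ∀ q x → (1# + q) * x ≈ q * (1# * x + 0#) + x
        expand = solve 2 (λ q x → (con 1 :+ q) :* x := q :* (con 1 :* x :+ con 0) :+ x) refl

    euler-rec : ∀ n → q * ∑ (ℕ.suc (ℕ.suc n)) (λ l → ι (ℕ.suc n C l) * E l) + E (ℕ.suc n) ≈ 0#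
    euler-rec n = trans (+-congʳ (*-congˡ (sym (sumRange≈∑ (ℕ.suc (ℕ.suc n)) 0 (ℕ.suc n) g P.refl))))
                        (isQEuler (ℕ.suc n))
      where g = λ l → ι (ℕ.suc n C l) * E l

    -- (k+1) ∑_{j=0}^{k} C(k,j) e_{k+1-j} = ∑_{i=0}^{k} C(k+1,i+1) E_{i+1}:
    -- reverse the sum (j = k - i), use C(k,k-i) = C(k,i), then absorb (k+1)/(i+1).
    scaled-conv : ∀ k → ι (ℕ.suc k) * conv (λ j → ι (k C j)) k
                        ≈ ∑ (ℕ.suc k) (λ i → ι (ℕ.suc k C ℕ.suc i) * E (ℕ.suc i))
    scaled-conv k = begin
      ι (ℕ.suc k) * ∑ (ℕ.suc k) f                    ≈⟨ ∑-*ˡ (ℕ.suc k) (ι (ℕ.suc k)) f ⟩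
      ∑ (ℕ.suc k) (λ j → ι (ℕ.suc k) * f j)          ≈⟨ ∑-reverse (ℕ.suc k) (λ j → ι (ℕ.suc k) * f j) ⟩
      ∑ (ℕ.suc k) (λ i → ι (ℕ.suc k) * f (k ℕ.∸ i))  ≈⟨ ∑-cong (ℕ.suc k) (λ i i<k+1 → reflected-term i (ℕₚ.≤-pred i<k+1)) ⟩
      ∑ (ℕ.suc k) (λ i → ι (ℕ.suc k C ℕ.suc i) * E (ℕ.suc i))  ∎
      where
      f : ℕ → Carrier
      f j = ι (k C j) * e (ℕ.suc k ℕ.∸ j)
      reflected-term : ∀ i → i ℕ.≤ k → ι (ℕ.suc k) * f (k ℕ.∸ i) ≈ ι (ℕ.suc k C ℕ.suc i) * E (ℕ.suc i)
      reflected-term i i≤k = begin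
        ι (ℕ.suc k) * (ι (k C (k ℕ.∸ i)) * e (ℕ.suc k ℕ.∸ (k ℕ.∸ i)))
          ≡⟨ P.cong₂ (λ a b → ι (ℕ.suc k) * (ι a * e b)) (P.sym (nCk≡nC[n∸k] i≤k))
                     (P.trans (ℕₚ.+-∸-assoc 1 (ℕₚ.m∸n≤m k i)) (P.cong ℕ.suc (ℕₚ.m∸[m∸n]≡n i≤k))) ⟩
        ι (ℕ.suc k) * (ι (k C i) * (E (ℕ.suc i) * inv (ℕ.suc i)))
          ≈⟨ *-assoc _ _ _ ⟨
        (ι (ℕ.suc k) * ι (k C i)) * (E (ℕ.suc i) * inv (ℕ.suc i))
          ≈⟨ *-congʳ (ι-absorption k i) ⟩
        (ι (ℕ.suc i) * ι (ℕ.suc k C ℕ.suc i)) * (E (ℕ.suc i) * inv (ℕ.suc i))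
          ≈⟨ regroup (ι (ℕ.suc i)) _ _ _ ⟩
        ι (ℕ.suc i) * ((ι (ℕ.suc k C ℕ.suc i) * E (ℕ.suc i)) * inv (ℕ.suc i))
          ≈⟨ ι-inv-cancel _ (λ ()) ⟩
        ι (ℕ.suc k C ℕ.suc i) * E (ℕ.suc i)
          ∎
        where
        regroup : ∀ a b x y → (a * b) * (x * y) ≈ a * ((b * x) * y)
        regroup = solve 4 (λ a b x y → (a :* b) :* (x :* y) := a :* ((b :* x) :* y)) refl

    -- The m = 0 case of the theorem:  q ∑_{j=0}^{k} C(k,j) e_{k+1-j} + e_{k+1} = -q/(k+1).
    -- Multiplied by k+1 it becomes the defining recurrence at k+1.
    euler-base : ∀ k → q * conv (λ j → ι (k C j)) k + e (ℕ.suc k) ≈ - (q * inv (ℕ.suc k))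
    euler-base k = inverseˡ-unique _ _ (ι-cancel {ℕ.suc k} (λ ()) (begin
      ι (ℕ.suc k) * ((q * A + E₁ * I) + q * I)                ≈⟨ distribute (ι (ℕ.suc k)) q A E₁ I ⟩
      q * (ι (ℕ.suc k) * A) + ι (ℕ.suc k) * (E₁ * I) + q * (ι (ℕ.suc k) * I)
                                                              ≈⟨ +-cong (+-cong (*-congˡ (scaled-conv k)) (ι-inv-cancel E₁ (λ ())))
                                                                        (*-congˡ (inv-correct (ℕ.suc k) (λ ()))) ⟩
      q * Q + E₁ + q * 1#                                     ≈⟨ collect q Q E₁ ⟩
      q * (1# + Q) + E₁                                       ≈⟨ +-congʳ (*-congˡ (+-congʳ E₀-term)) ⟨
      q * (ι (ℕ.suc k C 0) * E 0 + Q) + E₁                    ≈⟨ euler-rec k ⟩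
      0#                                                      ∎))
      where
      A  = conv (λ j → ι (k C j)) k
      E₁ = E (ℕ.suc k)
      I  = inv (ℕ.suc k)
      Q  = ∑ (ℕ.suc k) (λ i → ι (ℕ.suc k C ℕ.suc i) * E (ℕ.suc i))
      E₀-term : ι (ℕ.suc k C 0) * E 0 ≈ 1#
      E₀-term = trans (*-cong ι-1 E₀≈1) (*-identityˡ 1#)
      distribute : ∀ n q a x i → n * ((q * a + x * i) + q * i) ≈ q * (n * a) + n * (x * i) + q * (n * i)
      distribute = solve 5 (λ n q a x i → n :* ((q :* a :+ x :* i) :+ q :* i) := q :* (n :* a) :+ n :* (x :* i) :+ q :* (n :* i)) refl
      collect : ∀ q s x → q * s + x + q * 1# ≈ q * (1# + s) + x
      collect = solve 3 (λ q s x → q :* s :+ x :+ q :* con 1 := q :* (con 1 :+ s) :+ x) refl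

    γ : ℕ → ℕ → ℕ → Carrier
    γ k m j = q * ι (k C j) + sgn R j * ι (m C j)

    -- Pascal's rule for both binomials, the sign (-1)^{j+1} = -(-1)^j
    -- absorbing the mismatch in the second one.
    γ-pascal : ∀ k m j → γ (ℕ.suc k) m (ℕ.suc j) ≈ γ k (ℕ.suc m) (ℕ.suc j) + γ k m j
    γ-pascal k m j = begin
      q * ι (ℕ.suc k C ℕ.suc j) + - s * ι b′
        ≡⟨ P.cong (λ x → q * ι x + - s * ι b′) (P.sym (nCk+nC[k+1]≡[n+1]C[k+1] k j)) ⟩
      q * ι (a ℕ.+ a′) + - s * ι b′
        ≈⟨ +-congʳ (*-congˡ (ι-+ a a′)) ⟩
      q * (ι a + ι a′) + - s * ι b′
        ≈⟨ +-identityʳ _ ⟨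
      (q * (ι a + ι a′) + - s * ι b′) + 0#
        ≈⟨ +-congˡ (neg-cancel s (ι b)) ⟨
      (q * (ι a + ι a′) + - s * ι b′) + (- s * ι b + s * ι b)
        ≈⟨ regroup q (ι a) (ι a′) (- s) s (ι b) (ι b′) ⟩
      (q * ι a′ + - s * (ι b + ι b′)) + (q * ι a + s * ι b)
        ≈⟨ +-congʳ (+-congˡ (*-congˡ (ι-+ b b′))) ⟨
      (q * ι a′ + - s * ι (b ℕ.+ b′)) + (q * ι a + s * ι b)
        ≡⟨ P.cong (λ x → (q * ι a′ + - s * ι x) + (q * ι a + s * ι b)) (nCk+nC[k+1]≡[n+1]C[k+1] m j) ⟩
      γ k (ℕ.suc m) (ℕ.suc j) + γ k m j
        ∎
      where
      s  = sgn R j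
      a  = k C j
      a′ = k C ℕ.suc j
      b  = m C j
      b′ = m C ℕ.suc j
      regroup : ∀ q a a′ t s b c → (q * (a + a′) + t * c) + (t * b + s * b) ≈ (q * a′ + t * (b + c)) + (q * a + s * b)
      regroup = solve 7 (λ q a a′ t s b c → (q :* (a :+ a′) :+ t :* c) :+ (t :* b :+ s :* b)
                                          := (q :* a′ :+ t :* (b :+ c)) :+ (q :* a :+ s :* b)) refl

    T : ℕ → ℕ → Carrier
    T k m = conv (γ k m) (k ℕ.+ m)

    T-rec : ∀ k m → T (ℕ.suc k) m ≈ T k (ℕ.suc m) + T k m
    T-rec k m = begin
      conv (γ (ℕ.suc k) m) (ℕ.suc (k ℕ.+ m))                        ≈⟨ conv-pascal (k ℕ.+ m) {γ k m} {γ k (ℕ.suc m)} {γ (ℕ.suc k) m} refl (γ-pascal k m) ⟩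
      conv (γ k (ℕ.suc m)) (ℕ.suc (k ℕ.+ m)) + T k m                ≡⟨ P.cong (λ n → conv (γ k (ℕ.suc m)) n + T k m) (ℕₚ.+-suc k m) ⟨
      T k (ℕ.suc m) + T k m                                         ∎

    conv-δ : ∀ n → conv (λ j → sgn R j * ι (0 C j)) n ≈ e (ℕ.suc n)
    conv-δ n = begin
      (1# * ι 1) * e (ℕ.suc n) + ∑ n (λ j → (- sgn R j * ι (0 C ℕ.suc j)) * e (n ℕ.∸ j))
        ≈⟨ +-cong (*-congʳ (trans (*-identityˡ _) ι-1)) (∑-zero n vanish) ⟩
      1# * e (ℕ.suc n) + 0#     ≈⟨ trans (+-identityʳ _) (*-identityˡ _) ⟩
      e (ℕ.suc n)               ∎
      where
      vanish : ∀ j → (- sgn R j * ι (0 C ℕ.suc j)) * e (n ℕ.∸ j) ≈ 0#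
      vanish j = begin
        (- sgn R j * ι (0 C ℕ.suc j)) * e (n ℕ.∸ j)  ≡⟨ P.cong (λ x → (- sgn R j * ι x) * e (n ℕ.∸ j)) (k>n⇒nCk≡0 {0} {ℕ.suc j} ℕ.z<s) ⟩
        (- sgn R j * 0#) * e (n ℕ.∸ j)               ≈⟨ *-congʳ (zeroʳ _) ⟩
        0# * e (n ℕ.∸ j)                             ≈⟨ zeroˡ _ ⟩
        0#                                           ∎

    T-base : ∀ k → T k 0 ≈ q * (sgn R 1 * β k 0)
    T-base k = begin
      conv (γ k 0) (k ℕ.+ 0)                                          ≡⟨ P.cong (conv (γ k 0)) (ℕₚ.+-identityʳ k) ⟩
      conv (γ k 0) k                                                  ≈⟨ conv-+ k (λ j → q * ι (k C j)) (λ j → sgn R j * ι (0 C j)) ⟨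
      conv (λ j → q * ι (k C j)) k + conv (λ j → sgn R j * ι (0 C j)) k  ≈⟨ +-cong (sym (conv-*ˡ k q (λ j → ι (k C j)))) (conv-δ k) ⟩
      q * conv (λ j → ι (k C j)) k + e (ℕ.suc k)                      ≈⟨ euler-base k ⟩
      - (q * inv (ℕ.suc k))                                           ≈⟨ -‿distribʳ-* q _ ⟩
      q * - inv (ℕ.suc k)                                             ≈⟨ *-congˡ (-1*x≈-x _) ⟨
      q * (- 1# * inv (ℕ.suc k))                                      ≡⟨ P.cong (λ n → q * (- 1# * inv n)) k+1≡β-denominator ⟩
      q * (sgn R 1 * β k 0)                                           ∎
      where
      k+1≡β-denominator : ℕ.suc k P.≡ ℕ.suc (k ℕ.+ 0) ℕ.* ((k ℕ.+ 0) C k)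
      k+1≡β-denominator = P.sym (P.trans (P.cong (λ t → ℕ.suc t ℕ.* (t C k)) (ℕₚ.+-identityʳ k))
                                  (P.trans (P.cong (ℕ.suc k ℕ.*_) (nCn≡1 k)) (ℕₚ.*-identityʳ (ℕ.suc k))))

    T-closed : ∀ k m → T k m ≈ q * (sgn R (ℕ.suc m) * β k m)
    T-closed k m = alternating q T β T-base T-rec β-rec m k

    γ-vanish : ∀ k m j → k ℕ.⊔ m ℕ.< j → γ k m j ≈ 0#
    γ-vanish k m j k⊔m<j = begin
      q * ι (k C j) + sgn R j * ι (m C j)  ≡⟨ P.cong₂ (λ a b → q * ι a + sgn R j * ι b)
                                                      (k>n⇒nCk≡0 (ℕₚ.≤-<-trans (ℕₚ.m≤m⊔n k m) k⊔m<j))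
                                                      (k>n⇒nCk≡0 (ℕₚ.≤-<-trans (ℕₚ.m≤n⊔m k m) k⊔m<j)) ⟩
      q * 0# + sgn R j * 0#                ≈⟨ +-cong (zeroʳ q) (zeroʳ _) ⟩
      0# + 0#                              ≈⟨ +-identityʳ 0# ⟩
      0#                                   ∎

    T-split : ∀ k m → T k m ≈ two-q R q * e (ℕ.suc (k ℕ.+ m))
                               + sumRange R 1 (k ℕ.⊔ m) (λ j → γ k m j * e ((k ℕ.+ m) ℕ.∸ j ℕ.+ 1))
    T-split k m = begin
      γ k m 0 * e (ℕ.suc N) + ∑ N (λ j → γ k m (ℕ.suc j) * e (N ℕ.∸ j))
        ≈⟨ +-cong (*-congʳ γ₀≈[2]) (∑-truncate _ M≤N (λ j → trans (*-congʳ (γ-vanish k m _ (ℕₚ.m≤m+n (ℕ.suc M) j))) (zeroˡ _))) ⟩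
      two-q R q * e (ℕ.suc N) + ∑ M (λ j → γ k m (ℕ.suc j) * e (N ℕ.∸ j))
        ≈⟨ +-congˡ (∑-cong M (λ j j<M → *-congˡ (reflexive (P.cong e (reindex j j<M))))) ⟩
      two-q R q * e (ℕ.suc N) + ∑ M (λ j → F (ℕ.suc j))
        ≈⟨ +-congˡ (sumRange≈∑ M 1 M F P.refl) ⟨
      two-q R q * e (ℕ.suc N) + sumRange R 1 M F
        ∎
      where
      N = k ℕ.+ m
      M = k ℕ.⊔ m
      F = λ j → γ k m j * e (N ℕ.∸ j ℕ.+ 1)
      M≤N : M ℕ.≤ N
      M≤N = ℕₚ.m⊔n≤m+n k m
      γ₀≈[2] : γ k m 0 ≈ two-q R q
      γ₀≈[2] = trans (+-cong (trans (*-congˡ ι-1) (*-identityʳ q)) (trans (*-identityˡ _) ι-1)) (+-comm q 1#)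
      reindex : ∀ j → j ℕ.< M → N ℕ.∸ j P.≡ N ℕ.∸ ℕ.suc j ℕ.+ 1
      reindex j j<M = P.trans (ℕₚ.+-∸-assoc 1 (ℕₚ.<-≤-trans j<M M≤N)) (ℕₚ.+-comm 1 _)

-- The sum of the theorem is T(k,m) minus its j = 0 term (T-split), and
-- T(k,m) has the closed form T-closed; the rest is renaming indices.
theorem1 : {c ℓ : Level} (R : CommutativeRing c ℓ) →
    let open CommutativeRing R in
    (inv : ℕ → Carrier) →
    (∀ n → n ≢ 0 → fromℕ R n * inv n ≈ 1#) →
    (q u : Carrier) → two-q R q * u ≈ 1# →
    (E : ℕ → Carrier) → IsQEuler R q E →
    (k m : ℕ) →
    sumRange R 1 (k ℕ.⊔ m)
      (λ j → (q * fromℕ R (k C j) + sgn R j * fromℕ R (m C j))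
             * (E ((k ℕ.+ m) ℕ.∸ j ℕ.+ 1) * inv ((k ℕ.+ m) ℕ.∸ j ℕ.+ 1)))
    ≈ q * (sgn R (m ℕ.+ 1) * inv ((k ℕ.+ m ℕ.+ 1) ℕ.* ((k ℕ.+ m) C k)))
      - two-q R q * (E (k ℕ.+ m ℕ.+ 1) * inv (k ℕ.+ m ℕ.+ 1))
theorem1 R inv inv-correct q u [2]u≈1 E isQEuler k m = begin
  sumRange R 1 (k ℕ.⊔ m) (λ j → γ k m j * e (N ℕ.∸ j ℕ.+ 1))
    ≈⟨ x≈z//y _ _ _ (trans (+-comm _ _) (sym (T-split k m))) ⟩
  T k m - two-q R q * e (ℕ.suc N)
    ≈⟨ +-congʳ (T-closed k m) ⟩
  q * (sgn R (ℕ.suc m) * β k m) - two-q R q * e (ℕ.suc N)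
    ≡⟨ P.cong₂ (λ i n → q * (sgn R i * inv (n ℕ.* (N C k))) - two-q R q * e n) (ℕₚ.+-comm 1 m) (ℕₚ.+-comm 1 N) ⟩
  q * (sgn R (m ℕ.+ 1) * inv ((N ℕ.+ 1) ℕ.* (N C k))) - two-q R q * e (N ℕ.+ 1)
    ∎
  where
  open CommutativeRing R
  open Development R
  open QEuler inv inv-correct q u [2]u≈1 E isQEuler
  open import Algebra.Properties.Group +-group using (x≈z//y)
  open import Relation.Binary.Reasoning.Setoid setoid
  N = k ℕ.+ m
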